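{- For every integer $n\ge 1$ we have $p(n,1)=1$, and for all integers $n,k\ge 2$, $$p(n,k)=\sum_{m=1}^{\lfloor n/k\rfloor}\sum_{\nu=1}^{k-1}p(n-km,\nu).$$ Consequently, for $n\ge 2$, $$p(n)=1+\sum_{k=2}^{n}\sum_{m=1}^{\lfloor n/k\rfloor}\sum_{\nu=1}^{k-1}p(n-km,\nu).$$
   Context: A partition of a nonnegative integer $n$ is a multiset of positive integers (parts) summing to $n$. $p(n)$ is the number of partitions of $n$ and $p(n,k)$ the number of partitions of $n$ into exactly $k$ parts. Conventions: $p(0)=1$ and $p(0,1)=1$ (the empty partition of $0$ is counted as the unique partition of $0$); otherwise $p(n,k)=0$ whenever $n<0$, $k<1$, or $k>n$ (in particular $p(0,\nu)=0$ for $\nu\ge 2$). -}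

module Defs where

open import Data.Nat using (ℕ; zero; suc; _+_; _*_; _∸_; _≤_; _≥_; _≟_)
open import Data.Nat.Properties using (_≥?_; _≤?_)
open import Data.List using (List; []; _∷_; [_]; map; concatMap; length; filter; upTo)
open import Data.Nat.ListAction using (sum)
open import Data.Nat.DivMod using (_/_)
open import Data.List.Relation.Unary.All using (All; all?)
open import Data.List.Relation.Unary.Linked using (Linked; linked?)
open import Data.Product using (_×_)
open import Relation.Binary.PropositionalEquality using (_≡_)
open import Relation.Nullary using (Dec; _×-dec_)

-- A partition of n into exactly k parts is represented by its unique sorted
-- representative: a list of length k of positive integers, weakly decreasing,
-- summing to n.
IsPartition : ℕ → List ℕ → Set
IsPartition n xs = Linked _≥_ xs × All (1 ≤_) xs × sum xs ≡ n

isPartition? : (n : ℕ) (xs : List ℕ) → Dec (IsPartition n xs)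
isPartition? n xs = linked? _≥?_ xs ×-dec all? (1 ≤?_) xs ×-dec (sum xs ≟ n)

lists : (k b : ℕ) → List (List ℕ)
lists zero    b = [ [] ]
lists (suc k) b = concatMap (λ xs → map (_∷ xs) (upTo (suc b))) (lists k b)

-- number of partitions of n into exactly k parts, by exhaustive enumeration
-- (every part of a partition of n is ≤ n); here the empty list is the
-- partition of 0 into 0 parts.
countParts : ℕ → ℕ → ℕ
countParts n k = length (filter (isPartition? n) (lists k n))

-- p(n,k) with the paper's conventions: p(0,1) = 1 and p(0,ν) = 0 for ν ≠ 1;
-- for n ≥ 1 it is the number of partitions of n into exactly k parts.
p₂ : ℕ → ℕ → ℕ
p₂ zero    (suc zero) = 1
p₂ zero    _          = 0
p₂ (suc n) k          = countParts (suc n) k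

-- p(n): total number of partitions of n (a partition of n has at most n parts);
-- p(0) = 1 via the empty partition.
p : ℕ → ℕ
p n = sum (map (countParts n) (upTo (suc n)))

-- ∑_{i=a}^{b} f i  (empty when b < a)
∑[_⋯_] : ℕ → ℕ → (ℕ → ℕ) → ℕ
∑[ a ⋯ b ] f = sum (map (λ i → f (a + i)) (upTo (suc b ∸ a)))

-- ⌊n/k⌋; the value for k = 0 is irrelevant (never used: k ≥ 2 in the theorem)
⌊_/_⌋ : ℕ → ℕ → ℕ
⌊ n / zero ⌋  = 0
⌊ n / suc k ⌋ = n / suc k

{-# OPTIONS --safe #-}
-- Subtracting 1 from each part of a partition of n into k parts and discarding the
-- parts that become 0 is a bijection onto the partitions of n − k into at most k
-- parts, so p(n,k) = ∑_{ν<k} p(n−k,ν) + p(n−k,k), where p(0,0) = 1 counts the empty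
-- partition. Unfolding the last term ⌊n/k⌋ times, until the remainder is smaller
-- than k and has no partition into k parts, gives the formula; the paper's
-- convention p(0,1) = 1 is what stands in for p(0,0) = 1 once ν starts at 1.
module Submission where

open import Defs
open import Algebra.Properties.CommutativeSemigroup using (interchange)
open import Data.Bool using (Bool; true; false; _∧_; if_then_else_)
open import Data.Bool.Properties using (if-eta; if-cong; if-cong-then)
open import Data.List
  using (List; []; _∷_; _++_; [_]; map; concatMap; applyUpTo; upTo; filter; length)
open import Data.List.Properties using (map-++; map-∘; map-cong; map-applyUpTo; applyUpTo-∷ʳ)
open import Data.List.Relation.Unary.All using (All; _∷_; all?)
open import Data.List.Relation.Unary.Linked using (Linked; [-]; _∷_; tail; linked?)
open import Data.Nat
  using (ℕ; zero; suc; _≤_; _<_; _≥_; _+_; _*_; _∸_; _/_; z≤n; s≤s; z<s; s<s; _≤?_; _<?_; _≟_)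
open import Data.Nat.DivMod using (m<n⇒m/n≡0; m/n≡1+[m∸n]/n)
open import Data.Nat.Induction using (<-rec)
open import Data.Nat.ListAction using (sum)
open import Data.Nat.ListAction.Properties using (sum-++)
open import Data.Nat.Properties
open import Data.Product using (_×_; _,_)
open import Function using (_∘_; id)
open import Function.Bundles using (_⇔_; mk⇔)
open import Relation.Binary.PropositionalEquality
  using (_≡_; refl; sym; trans; cong; cong₂; subst; module ≡-Reasoning)
open import Relation.Nullary using (Dec; yes; no; ¬_; does; _×-dec_)
open import Relation.Nullary.Decidable using (dec-true; dec-false; does-⇔)
open import Relation.Unary using (Decidable)

open ≡-Reasoning

∑< : ℕ → (ℕ → ℕ) → ℕ
∑< c f = sum (applyUpTo f c)

∑<-cong : ∀ c {f g : ℕ → ℕ} → (∀ {i} → i < c → f i ≡ g i) → ∑< c f ≡ ∑< c g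
∑<-cong zero    f≡g = refl
∑<-cong (suc c) f≡g = cong₂ _+_ (f≡g z<s) (∑<-cong c (f≡g ∘ s<s))

∑<-zeros : ∀ c {f : ℕ → ℕ} → (∀ {i} → i < c → f i ≡ 0) → ∑< c f ≡ 0
∑<-zeros zero    f≡0 = refl
∑<-zeros (suc c) f≡0 = cong₂ _+_ (f≡0 z<s) (∑<-zeros c (f≡0 ∘ s<s))

∑<-+ : ∀ c (f g : ℕ → ℕ) → ∑< c (λ i → f i + g i) ≡ ∑< c f + ∑< c g
∑<-+ zero    f g = refl
∑<-+ (suc c) f g =
  trans (cong (f 0 + g 0 +_) (∑<-+ c (f ∘ suc) (g ∘ suc)))
        (interchange +-commutativeSemigroup (f 0) (g 0) _ _)

∑<-split : ∀ a b (f : ℕ → ℕ) → ∑< (a + b) f ≡ ∑< a f + ∑< b (λ i → f (a + i))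
∑<-split zero    b f = refl
∑<-split (suc a) b f = trans (cong (f 0 +_) (∑<-split a b (f ∘ suc))) (sym (+-assoc (f 0) _ _))

∑<-last : ∀ c (f : ℕ → ℕ) → ∑< (suc c) f ≡ ∑< c f + f c
∑<-last c f = begin
  sum (applyUpTo f (suc c))       ≡⟨ cong sum (applyUpTo-∷ʳ f c) ⟨
  sum (applyUpTo f c ++ [ f c ])  ≡⟨ sum-++ (applyUpTo f c) [ f c ] ⟩
  ∑< c f + (f c + 0)              ≡⟨ cong (∑< c f +_) (+-identityʳ (f c)) ⟩
  ∑< c f + f c                    ∎

∑<-vanishing-tail : ∀ {c d} (f : ℕ → ℕ) → c ≤ d →
                    (∀ {i} → c ≤ i → i < d → f i ≡ 0) → ∑< d f ≡ ∑< c f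
∑<-vanishing-tail {c} {d} f c≤d tail≡0 = begin
  ∑< d f                                  ≡⟨ cong (λ e → ∑< e f) (m+[n∸m]≡n c≤d) ⟨
  ∑< (c + (d ∸ c)) f                      ≡⟨ ∑<-split c (d ∸ c) f ⟩
  ∑< c f + ∑< (d ∸ c) (λ i → f (c + i))   ≡⟨ cong (∑< c f +_) (∑<-zeros (d ∸ c) in-tail) ⟩
  ∑< c f + 0                              ≡⟨ +-identityʳ (∑< c f) ⟩
  ∑< c f                                  ∎
  where
  in-tail : ∀ {i} → i < d ∸ c → f (c + i) ≡ 0
  in-tail {i} i<d∸c =
    tail≡0 (m≤m+n c i) (subst (c + i <_) (m+[n∸m]≡n c≤d) (+-monoʳ-< c i<d∸c))

∑<-swap : ∀ a b (f : ℕ → ℕ → ℕ) →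
          ∑< a (λ i → ∑< b (f i)) ≡ ∑< b (λ j → ∑< a (λ i → f i j))
∑<-swap zero    b f = sym (∑<-zeros b (λ _ → refl))
∑<-swap (suc a) b f =
  trans (cong (∑< b (f 0) +_) (∑<-swap a b (f ∘ suc))) (sym (∑<-+ b (f 0) _))

∑<-if : ∀ c b (f : ℕ → ℕ) →
        ∑< c (λ i → if b then f i else 0) ≡ (if b then ∑< c f else 0)
∑<-if c true  f = refl
∑<-if c false f = ∑<-zeros c (λ _ → refl)

∑[⋯]≡∑< : ∀ a b (f : ℕ → ℕ) →
          ∑[ a ⋯ b ] f ≡ ∑< (suc b ∸ a) (λ i → f (a + i))
∑[⋯]≡∑< a b f = cong sum (map-applyUpTo id (λ i → f (a + i)) (suc b ∸ a))

indicator : {A : Set} → Dec A → ℕ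
indicator a? = if does a? then 1 else 0

count : {A : Set} {P : A → Set} → Decidable P → List A → ℕ
count P? xs = sum (map (indicator ∘ P?) xs)

length-filter≡count : {A : Set} {P : A → Set} (P? : Decidable P) (xs : List A) →
                      length (filter P? xs) ≡ count P? xs
length-filter≡count P? []       = refl
length-filter≡count P? (x ∷ xs) with does (P? x)
... | true  = cong suc (length-filter≡count P? xs)
... | false = length-filter≡count P? xs

count-cong : {A : Set} {P Q : A → Set} (P? : Decidable P) (Q? : Decidable Q) →
             (∀ x → P x ⇔ Q x) → (xs : List A) → count P? xs ≡ count Q? xs
count-cong P? Q? P⇔Q []       = refl
count-cong P? Q? P⇔Q (x ∷ xs) =
  cong₂ _+_ (if-cong (does-⇔ (P⇔Q x) (P? x) (Q? x))) (count-cong P? Q? P⇔Q xs)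

count-none : {A : Set} {P : A → Set} (P? : Decidable P) → (∀ x → ¬ P x) → (xs : List A) →
             count P? xs ≡ 0
count-none P? ¬P []       = refl
count-none P? ¬P (x ∷ xs) = cong₂ _+_ (if-cong (dec-false (P? x) (¬P x))) (count-none P? ¬P xs)

sum-map-∑< : {A : Set} (c : ℕ) (f : ℕ → A → ℕ) (xs : List A) →
             sum (map (λ x → ∑< c (λ i → f i x)) xs) ≡ ∑< c (λ i → sum (map (f i) xs))
sum-map-∑< c f []       = sym (∑<-zeros c (λ _ → refl))
sum-map-∑< c f (x ∷ xs) =
  trans (cong (∑< c (λ i → f i x) +_) (sum-map-∑< c f xs)) (sym (∑<-+ c (λ i → f i x) _))

sum-map-concatMap : {A B : Set} (g : B → ℕ) (f : A → List B) (xs : List A) →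
                    sum (map g (concatMap f xs)) ≡ sum (map (λ x → sum (map g (f x))) xs)
sum-map-concatMap g f []       = refl
sum-map-concatMap g f (x ∷ xs) = begin
  sum (map g (f x ++ concatMap f xs))
    ≡⟨ cong sum (map-++ g (f x) (concatMap f xs)) ⟩
  sum (map g (f x) ++ map g (concatMap f xs))
    ≡⟨ sum-++ (map g (f x)) _ ⟩
  sum (map g (f x)) + sum (map g (concatMap f xs))
    ≡⟨ cong (sum (map g (f x)) +_) (sum-map-concatMap g f xs) ⟩
  sum (map g (f x)) + sum (map (λ y → sum (map g (f y))) xs) ∎

δ : ℕ → ℕ
δ zero    = 1
δ (suc _) = 0

-- the number of weakly decreasing lists of length k with entries in [l, h] and
-- sum n, by their first entry x
descending : ℕ → ℕ → ℕ → ℕ → ℕ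
descending zero    n l h = δ n
descending (suc k) n l h =
  ∑< (suc n) (λ x → if does (l ≤? x ×-dec x ≤? h) then descending k (n ∸ x) l x else 0)

descending-zeros : ∀ k n → descending k n 0 0 ≡ δ n
descending-zeros zero    n = refl
descending-zeros (suc k) n =
  trans (cong₂ _+_ (descending-zeros k n) (∑<-zeros n (λ _ → refl))) (+-identityʳ (δ n))

descending-sum<length : ∀ {k n} h → n < k → descending k n 1 h ≡ 0
descending-sum<length {suc k} {n} h n<1+k = ∑<-zeros (suc n) term≡0
  where
  term≡0 : ∀ {x} → x < suc n →
           (if does (1 ≤? x ×-dec x ≤? h) then descending k (n ∸ x) 1 x else 0) ≡ 0
  term≡0 {zero}  _     = refl
  term≡0 {suc x} x<1+n =
    trans (if-cong-then (does (suc x ≤? h)) (descending-sum<length (suc x) n∸x<k)) (if-eta _)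
    where
    n∸x<k : n ∸ suc x < k
    n∸x<k = <-≤-trans (∸-monoʳ-< z<s (≤-pred x<1+n)) (≤-pred n<1+k)

descending-cap : ∀ k {n} l {h} → n ≤ h → descending k n l h ≡ descending k n l n
descending-cap zero    l n≤h = refl
descending-cap (suc k) {n} l {h} n≤h = ∑<-cong (suc n) (λ {x} x<1+n →
  if-cong {x = descending k (n ∸ x) l x} {y = 0} (same-bounds (≤-pred x<1+n)))
  where
  same-bounds : ∀ {x} → x ≤ n →
                does (l ≤? x ×-dec x ≤? h) ≡ does (l ≤? x ×-dec x ≤? n)
  same-bounds {x} x≤n = cong (does (l ≤? x) ∧_)
    (trans (dec-true (x ≤? h) (≤-trans x≤n n≤h)) (sym (dec-true (x ≤? n) x≤n)))

descending-shift : ∀ k n h → descending k (k + n) 1 (suc h) ≡ descending k n 0 h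
descending-shift zero    n h = refl
descending-shift (suc k) n h = begin
  ∑< (suc (k + n)) shifted  ≡⟨ ∑<-vanishing-tail shifted (s≤s (m≤n+m n k)) beyond ⟩
  ∑< (suc n) shifted        ≡⟨ ∑<-cong (suc n) (unshift ∘ ≤-pred) ⟩
  descending (suc k) n 0 h  ∎
  where
  shifted : ℕ → ℕ
  shifted y = if does (y ≤? h) then descending k (k + n ∸ y) 1 (suc y) else 0

  beyond : ∀ {y} → suc n ≤ y → y < suc (k + n) → shifted y ≡ 0
  beyond {y} n<y y<1+k+n =
    trans (if-cong-then (does (y ≤? h)) (descending-sum<length (suc y) k+n∸y<k))
          (if-eta (does (y ≤? h)))
    where
    k+n∸y<k : k + n ∸ y < k
    k+n∸y<k = subst (k + n ∸ y <_) (m+n∸n≡m k n) (∸-monoʳ-< n<y (≤-pred y<1+k+n))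

  unshift : ∀ {y} → y ≤ n →
            shifted y ≡ (if does (y ≤? h) then descending k (n ∸ y) 0 y else 0)
  unshift {y} y≤n = if-cong-then (does (y ≤? h)) (begin
    descending k (k + n ∸ y) 1 (suc y)
      ≡⟨ cong (λ m → descending k m 1 (suc y)) (+-∸-assoc k y≤n) ⟩
    descending k (k + (n ∸ y)) 1 (suc y)
      ≡⟨ descending-shift k (n ∸ y) y ⟩
    descending k (n ∸ y) 0 y ∎)

descending-pad : ∀ k n h → descending k n 0 h ≡ ∑< (suc k) (λ ν → descending ν n 1 h)
descending-pad zero    n h = sym (+-identityʳ (δ n))
descending-pad (suc k) n h = cong₂ _+_ (descending-zeros k n) (begin
  ∑< n (λ x → if b x then descending k (n ∸ suc x) 0 (suc x) else 0)
    ≡⟨ ∑<-cong n (λ {x} _ → if-cong-then (b x) (descending-pad k (n ∸ suc x) (suc x))) ⟩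
  ∑< n (λ x → if b x then ∑< (suc k) (λ ν → term ν x) else 0)
    ≡⟨ ∑<-cong n (λ {x} _ → sym (∑<-if (suc k) (b x) (λ ν → term ν x))) ⟩
  ∑< n (λ x → ∑< (suc k) (λ ν → if b x then term ν x else 0))
    ≡⟨ ∑<-swap n (suc k) (λ x ν → if b x then term ν x else 0) ⟩
  ∑< (suc k) (λ ν → ∑< n (λ x → if b x then term ν x else 0)) ∎)
  where
  b : ℕ → Bool
  b x = does (suc x ≤? h)

  term : ℕ → ℕ → ℕ
  term ν x = descending ν (n ∸ suc x) 1 (suc x)

partitions : ℕ → ℕ → ℕ
partitions n k = descending k n 1 n

partitionsBelow : ℕ → ℕ → ℕ
partitionsBelow n k = ∑< k (partitions n)

partitions-shift : ∀ k m → partitions (k + m) k ≡ partitionsBelow m (suc k)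
partitions-shift zero    m = sym (+-identityʳ (δ m))
partitions-shift (suc k) m = begin
  descending (suc k) (suc k + m) 1 (suc (k + m))     ≡⟨ descending-shift (suc k) m (k + m) ⟩
  descending (suc k) m 0 (k + m)                     ≡⟨ descending-pad (suc k) m (k + m) ⟩
  ∑< (suc (suc k)) (λ ν → descending ν m 1 (k + m))  ≡⟨ ∑<-cong (suc (suc k)) (λ {ν} _ →
                                                          descending-cap ν 1 (m≤n+m m k)) ⟩
  partitionsBelow m (suc (suc k))                    ∎

partitions-peel : ∀ {n k} → k ≤ n →
                  partitions n k ≡ partitionsBelow (n ∸ k) k + partitions (n ∸ k) k
partitions-peel {n} {k} k≤n = begin
  partitions n k                    ≡⟨ cong (λ m → partitions m k) (m+[n∸m]≡n k≤n) ⟨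
  partitions (k + (n ∸ k)) k        ≡⟨ partitions-shift k (n ∸ k) ⟩
  partitionsBelow (n ∸ k) (suc k)   ≡⟨ ∑<-last k (partitions (n ∸ k)) ⟩
  partitionsBelow (n ∸ k) k + partitions (n ∸ k) k ∎

partitions-into-one : ∀ n → partitions (suc n) 1 ≡ 1
partitions-into-one zero    = refl
partitions-into-one (suc n) =
  trans (partitions-peel {suc (suc n)} (s≤s z≤n)) (partitions-into-one n)

partitions-unfold : ∀ k n →
  partitions n (suc k) ≡ ∑< (n / suc k) (λ i → partitionsBelow (n ∸ suc k * suc i) (suc k))
partitions-unfold k = <-rec Unfolds unfold
  where
  K : ℕ
  K = suc k

  remainders : ℕ → ℕ → ℕ
  remainders n i = partitionsBelow (n ∸ K * suc i) K

  Unfolds : ℕ → Set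
  Unfolds n = partitions n K ≡ ∑< (n / K) (remainders n)

  unfold : ∀ n → (∀ {m} → m < n → Unfolds m) → Unfolds n
  unfold n rec with n <? K
  ... | yes n<K = begin
    partitions n K          ≡⟨ descending-sum<length n n<K ⟩
    0                       ≡⟨ cong (λ q → ∑< q (remainders n)) (m<n⇒m/n≡0 n<K) ⟨
    ∑< (n / K) (remainders n) ∎
  ... | no n≮K = begin
    partitions n K
      ≡⟨ partitions-peel K≤n ⟩
    partitionsBelow (n ∸ K) K + partitions (n ∸ K) K
      ≡⟨ cong₂ _+_ (cong (λ j → partitionsBelow (n ∸ j) K) (sym (*-identityʳ K)))
                   (rec (∸-monoʳ-< z<s K≤n)) ⟩
    remainders n 0 + ∑< ((n ∸ K) / K) (remainders (n ∸ K))
      ≡⟨ cong (remainders n 0 +_) (∑<-cong ((n ∸ K) / K) (λ {i} _ →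
           cong (λ m → partitionsBelow m K) (n∸K∸K[1+i]≡n∸K[2+i] i))) ⟩
    ∑< (suc ((n ∸ K) / K)) (remainders n)
      ≡⟨ cong (λ q → ∑< q (remainders n)) (m/n≡1+[m∸n]/n K≤n) ⟨
    ∑< (n / K) (remainders n) ∎
    where
    K≤n : K ≤ n
    K≤n = ≮⇒≥ n≮K

    n∸K∸K[1+i]≡n∸K[2+i] : ∀ i → n ∸ K ∸ K * suc i ≡ n ∸ K * suc (suc i)
    n∸K∸K[1+i]≡n∸K[2+i] i =
      trans (∸-+-assoc n K (K * suc i)) (cong (n ∸_) (sym (*-suc K (suc i))))

sum-map-lists-suc : ∀ k b (F : List ℕ → ℕ) →
  sum (map F (lists (suc k) b)) ≡
  ∑< (suc b) (λ x → sum (map (λ xs → F (x ∷ xs)) (lists k b)))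
sum-map-lists-suc k b F = begin
  sum (map F (concatMap (λ xs → map (_∷ xs) (upTo (suc b))) (lists k b)))
    ≡⟨ sum-map-concatMap F _ (lists k b) ⟩
  sum (map (λ xs → sum (map F (map (_∷ xs) (upTo (suc b))))) (lists k b))
    ≡⟨ cong sum (map-cong (λ xs → cong sum (trans (sym (map-∘ (upTo (suc b))))
                                (map-applyUpTo id (F ∘ (_∷ xs)) (suc b)))) (lists k b)) ⟩
  sum (map (λ xs → ∑< (suc b) (λ x → F (x ∷ xs))) (lists k b))
    ≡⟨ sum-map-∑< (suc b) (λ x xs → F (x ∷ xs)) (lists k b) ⟩
  ∑< (suc b) (λ x → sum (map (λ xs → F (x ∷ xs)) (lists k b))) ∎

IsPartitionAtMost : ℕ → ℕ → List ℕ → Set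
IsPartitionAtMost h n xs = Linked _≥_ (h ∷ xs) × All (1 ≤_) xs × sum xs ≡ n

isPartitionAtMost? : ∀ h n xs → Dec (IsPartitionAtMost h n xs)
isPartitionAtMost? h n xs = linked? _≥?_ (h ∷ xs) ×-dec all? (1 ≤?_) xs ×-dec (sum xs ≟ n)

sum∷-linked : ∀ {xs} → Linked _≥_ xs → Linked _≥_ (sum xs ∷ xs)
sum∷-linked {[]}     _   = [-]
sum∷-linked {x ∷ xs} x≥⋯ = m≤m+n x (sum xs) ∷ x≥⋯

isPartition⇔isPartitionAtMost : ∀ n xs → IsPartition n xs ⇔ IsPartitionAtMost n n xs
isPartition⇔isPartitionAtMost n xs = mk⇔
  (λ (x≥⋯ , 1≤xs , Σxs≡n) →
     subst (λ m → Linked _≥_ (m ∷ xs)) Σxs≡n (sum∷-linked x≥⋯) , 1≤xs , Σxs≡n)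
  (λ (n≥x≥⋯ , 1≤xs , Σxs≡n) → tail n≥x≥⋯ , 1≤xs , Σxs≡n)

isPartitionAtMost-∷ : ∀ {h n x} → 1 ≤ x × x ≤ h → x ≤ n → ∀ xs →
                      IsPartitionAtMost h n (x ∷ xs) ⇔ IsPartitionAtMost x (n ∸ x) xs
isPartitionAtMost-∷ {n = n} {x} (1≤x , x≤h) x≤n xs = mk⇔
  (λ { (_ ∷ x≥⋯ , _ ∷ 1≤xs , x+Σxs≡n) →
        x≥⋯ , 1≤xs , trans (sym (m+n∸m≡n x (sum xs))) (cong (_∸ x) x+Σxs≡n) })
  (λ (x≥⋯ , 1≤xs , Σxs≡n∸x) →
     x≤h ∷ x≥⋯ , 1≤x ∷ 1≤xs , trans (cong (x +_) Σxs≡n∸x) (m+[n∸m]≡n x≤n))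

count-cons : ∀ h {n x} → x ≤ n → (xss : List (List ℕ)) →
  count (λ xs → isPartitionAtMost? h n (x ∷ xs)) xss ≡
  (if does (1 ≤? x ×-dec x ≤? h) then count (isPartitionAtMost? x (n ∸ x)) xss else 0)
count-cons h {n} {x} x≤n xss with 1 ≤? x ×-dec x ≤? h
... | yes bounds = trans
  (count-cong (λ xs → isPartitionAtMost? h n (x ∷ xs)) (isPartitionAtMost? x (n ∸ x))
              (isPartitionAtMost-∷ bounds x≤n) xss)
  (sym (if-cong {y = 0} (dec-true (1 ≤? x ×-dec x ≤? h) bounds)))
... | no out-of-bounds = trans
  (count-none (λ xs → isPartitionAtMost? h n (x ∷ xs))
     (λ { xs (x≤h ∷ _ , 1≤x ∷ _ , _) → out-of-bounds (1≤x , x≤h) }) xss)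
  (sym (if-cong {x = count (isPartitionAtMost? x (n ∸ x)) xss}
                 (dec-false (1 ≤? x ×-dec x ≤? h) out-of-bounds)))

count-too-large : ∀ h {n x} → n < x → (xss : List (List ℕ)) →
  count (λ xs → isPartitionAtMost? h n (x ∷ xs)) xss ≡ 0
count-too-large h {n} {x} n<x = count-none (λ xs → isPartitionAtMost? h n (x ∷ xs))
  (λ xs (_ , _ , x+Σxs≡n) → <⇒≱ n<x (subst (x ≤_) x+Σxs≡n (m≤m+n x (sum xs))))

count-isPartitionAtMost : ∀ k h {n b} → n ≤ b →
  count (isPartitionAtMost? h n) (lists k b) ≡ descending k n 1 h
count-isPartitionAtMost zero    h {zero}  _   = refl
count-isPartitionAtMost zero    h {suc n} _   = refl
count-isPartitionAtMost (suc k) h {n} {b} n≤b = begin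
  count (isPartitionAtMost? h n) (lists (suc k) b)
    ≡⟨ sum-map-lists-suc k b (indicator ∘ isPartitionAtMost? h n) ⟩
  ∑< (suc b) heads
    ≡⟨ ∑<-vanishing-tail heads (s≤s n≤b) (λ n<x _ → count-too-large h n<x (lists k b)) ⟩
  ∑< (suc n) heads
    ≡⟨ ∑<-cong (suc n) (λ {x} x<1+n → trans (count-cons h (≤-pred x<1+n) (lists k b))
         (if-cong-then (does (1 ≤? x ×-dec x ≤? h))
           (count-isPartitionAtMost k x (≤-trans (m∸n≤m n x) n≤b)))) ⟩
  descending (suc k) n 1 h ∎
  where
  heads : ℕ → ℕ
  heads x = count (λ xs → isPartitionAtMost? h n (x ∷ xs)) (lists k b)

countParts≡partitions : ∀ n k → countParts n k ≡ partitions n k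
countParts≡partitions n k = begin
  length (filter (isPartition? n) (lists k n))
    ≡⟨ length-filter≡count (isPartition? n) (lists k n) ⟩
  count (isPartition? n) (lists k n)
    ≡⟨ count-cong (isPartition? n) (isPartitionAtMost? n n)
                  (isPartition⇔isPartitionAtMost n) (lists k n) ⟩
  count (isPartitionAtMost? n n) (lists k n)
    ≡⟨ count-isPartitionAtMost k n ≤-refl ⟩
  partitions n k ∎

p≡∑<countParts : ∀ n → p n ≡ ∑< (suc n) (countParts n)
p≡∑<countParts n = cong sum (map-applyUpTo id (countParts n) (suc n))

∑p₂≡partitionsBelow : ∀ k m → ∑[ 1 ⋯ suc k ] (p₂ m) ≡ partitionsBelow m (suc (suc k))
∑p₂≡partitionsBelow k m = trans (∑[⋯]≡∑< 1 (suc k) (p₂ m)) (from-one m)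
  where
  from-one : ∀ m → ∑< (suc k) (λ ν → p₂ m (suc ν)) ≡ partitionsBelow m (suc (suc k))
  from-one zero    =
    cong suc (trans (∑<-zeros k (λ _ → refl)) (sym (∑<-zeros (suc k) (λ _ → refl))))
  from-one (suc m) = ∑<-cong (suc k) (λ {ν} _ → countParts≡partitions (suc m) (suc ν))

p₂-into-one : ∀ n → 1 ≤ n → p₂ n 1 ≡ 1
p₂-into-one (suc n) _ = trans (countParts≡partitions (suc n) 1) (partitions-into-one n)

expansion : ℕ → ℕ → ℕ
expansion n k =
  ∑[ 1 ⋯ ⌊ n / k ⌋ ] (λ m → ∑[ 1 ⋯ k ∸ 1 ] (λ ν → p₂ (n ∸ k * m) ν))

p₂≡expansion : ∀ n k → 2 ≤ k → p₂ n k ≡ expansion n k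
p₂≡expansion zero      (suc (suc _))       (s≤s (s≤s _)) = refl
p₂≡expansion n@(suc _) k@(suc (suc k-2)) (s≤s (s≤s _)) = begin
  countParts n k
    ≡⟨ countParts≡partitions n k ⟩
  partitions n k
    ≡⟨ partitions-unfold (suc k-2) n ⟩
  ∑< (n / k) (λ i → partitionsBelow (n ∸ k * suc i) k)
    ≡⟨ ∑<-cong (n / k) (λ {i} _ → ∑p₂≡partitionsBelow k-2 (n ∸ k * suc i)) ⟨
  ∑< (n / k) (λ i → ∑[ 1 ⋯ k ∸ 1 ] (p₂ (n ∸ k * suc i)))
    ≡⟨ ∑[⋯]≡∑< 1 (n / k) layer ⟨
  expansion n k ∎
  where
  layer : ℕ → ℕ
  layer m = ∑[ 1 ⋯ k ∸ 1 ] (p₂ (n ∸ k * m))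

p≡1+∑expansion : ∀ n → 2 ≤ n → p n ≡ 1 + ∑[ 2 ⋯ n ] (expansion n)
p≡1+∑expansion n@(suc (suc n-2)) (s≤s (s≤s _)) = begin
  p n
    ≡⟨ p≡∑<countParts n ⟩
  p₂ n 1 + ∑< (suc n-2) (λ i → p₂ n (2 + i))
    ≡⟨ cong₂ _+_ (p₂-into-one n (s≤s z≤n))
                 (∑<-cong (suc n-2) (λ {i} _ → p₂≡expansion n (2 + i) (s≤s (s≤s z≤n)))) ⟩
  1 + ∑< (suc n-2) (λ i → expansion n (2 + i))
    ≡⟨ cong suc (∑[⋯]≡∑< 2 n (expansion n)) ⟨
  1 + ∑[ 2 ⋯ n ] (expansion n) ∎

theorem2 : ((n : ℕ) → 1 ≤ n → p₂ n 1 ≡ 1)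
    × ((n k : ℕ) → 2 ≤ n → 2 ≤ k →
        p₂ n k ≡ ∑[ 1 ⋯ ⌊ n / k ⌋ ] (λ m → ∑[ 1 ⋯ k ∸ 1 ] (λ ν → p₂ (n ∸ k * m) ν)))
    × ((n : ℕ) → 2 ≤ n →
        p n ≡ 1 + ∑[ 2 ⋯ n ] (λ k → ∑[ 1 ⋯ ⌊ n / k ⌋ ] (λ m → ∑[ 1 ⋯ k ∸ 1 ] (λ ν → p₂ (n ∸ k * m) ν))))
theorem2 = p₂-into-one , (λ n k _ → p₂≡expansion n k) , p≡1+∑expansion
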